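{- Let $n\ge 1$, $A\subseteq[n]$ and $1\le k\le n+1$. For $B\subseteq[n]$ and $1\le i\le n+1$, placing $R(B,i)$ directly below $R(A,k)$ yields a placement of $2n$ pairwise nonattacking kings on the $4\times 2n$ board if and only if $B\subseteq A$ and $p(A,B,k)\le i\le q(A,B,k)$, where \[p(A,B,k)=\max\big(\{j\in[n+1]: j<k,\ j\notin A,\ j-1\in B\}\cup\{1\}\big),\] \[q(A,B,k)=\min\big(\{j\in[n+1]: j>k,\ j\in B,\ j-1\notin A\}\cup\{n+1\}\big).\]
   Context: Two kings attack each other if their cells are distinct and adjacent horizontally, vertically or diagonally. A $2\times 2n$ rectangle has a top and a bottom row and columns $1,\dots,2n$; it is partitioned into $n$ squares of size $2\times 2$, square $j$ consisting of columns $2j-1$ (left column) and $2j$ (right column). For $A\subseteq[n]=\{1,\dots,n\}$ and $1\le k\le n+1$, $R(A,k)$ is the placement of $n$ kings with exactly one king in each square $j$, in the top row of the square iff $j\in A$, and in the left column of the square iff $j<k$ (right column iff $j\ge k$). Every placement of $n$ nonattacking kings on a $2\times 2n$ rectangle is of the form $R(A,k)$ for a unique pair $(A,k)$. Placing one $2\times 2n$ rectangle directly below another means forming a $4\times 2n$ board whose top two rows are the upper rectangle and bottom two rows the lower one, columns aligned. -}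

module Defs where

open import Data.Bool using (Bool; true; false; if_then_else_; not; _∧_)
open import Data.Nat using (ℕ; zero; suc; _+_; _*_; _∸_; _≤_; _<ᵇ_; _⊔_; _⊓_; ∣_-_∣)
open import Data.Fin using (Fin; toℕ)
open import Data.Fin.Subset using (Subset)
open import Data.Vec using (Vec; []; _∷_; lookup)
open import Data.List using (List; applyUpTo; filterᵇ; foldr)
open import Data.Product using (_×_; _,_)
open import Data.Sum using (_⊎_; inj₁; inj₂)
open import Relation.Binary.PropositionalEquality using (_≡_; _≢_)
open import Relation.Nullary using (¬_)

-- A cell of the board: (row , column), rows numbered from the top starting at 1,
-- columns numbered from the left starting at 1.
Cell : Set
Cell = ℕ × ℕ

Attack : Cell → Cell → Set
Attack (r , c) (r' , c') = ((r , c) ≢ (r' , c')) × (∣ r - r' ∣ ≤ 1) × (∣ c - c' ∣ ≤ 1)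

NonattackingPlacement : {I : Set} → (I → Cell) → Set
NonattackingPlacement {I} f =
  (∀ x y → f x ≡ f y → x ≡ y) × (∀ x y → ¬ Attack (f x) (f y))

-- Membership of a natural number j in a subset A ⊆ [n] = {1,…,n}
-- (A : Subset n, element j ∈ [n] corresponds to index j-1 : Fin n).
-- Numbers outside [n] (in particular 0 and n+1) are not members.
_∈ℕᵇ_ : {n : ℕ} → ℕ → Subset n → Bool
j             ∈ℕᵇ []      = false
zero          ∈ℕᵇ (b ∷ A) = false
suc zero      ∈ℕᵇ (b ∷ A) = b
suc (suc j)   ∈ℕᵇ (b ∷ A) = suc j ∈ℕᵇ A

-- R(A,k) on a 2×2n rectangle whose top row is board row (off+1):
-- the king of square j (1-based: toℕ j + 1) is in the top row iff j ∈ A,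
-- and in the left column 2j-1 iff j < k (right column 2j otherwise).
R : {n : ℕ} → ℕ → Subset n → ℕ → Fin n → Cell
R off A k j =
  ( off + (if lookup A j then 1 else 2)
  , (if (jj <ᵇ k) then (2 * jj ∸ 1) else (2 * jj)) )
  where jj = suc (toℕ j)

stacked : {n : ℕ} → Subset n → ℕ → Subset n → ℕ → Fin n ⊎ Fin n → Cell
stacked A k B i (inj₁ j) = R 0 A k j
stacked A k B i (inj₂ j) = R 2 B i j

range1 : ℕ → List ℕ
range1 n = applyUpTo suc (suc n)

p : {n : ℕ} → Subset n → Subset n → ℕ → ℕ
p {n} A B k =
  foldr _⊔_ 1
    (filterᵇ (λ j → (j <ᵇ k) ∧ not (j ∈ℕᵇ A) ∧ ((j ∸ 1) ∈ℕᵇ B)) (range1 n))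

q : {n : ℕ} → Subset n → Subset n → ℕ → ℕ
q {n} A B k =
  foldr _⊓_ (suc n)
    (filterᵇ (λ j → (k <ᵇ j) ∧ (j ∈ℕᵇ B) ∧ not ((j ∸ 1) ∈ℕᵇ A)) (range1 n))

-- Kings of one rectangle never attack: they lie in distinct squares, and the columns of
-- squares j and j + 1 touch only when square j uses its right column and square j + 1 its
-- left one, which the single left/right switch at k rules out.  An upper king attacks a
-- lower one only when the first is in row 2 (square j ∉ A), the second in row 3
-- (square j' ∈ B), and their columns touch.  Each of the three ways of touching is ruled
-- out by exactly one condition: j = j' by B ⊆ A; j' = j + 1 (upper right, lower left) by
-- i ≤ q(A,B,k); and j = j' + 1 (upper left, lower right) by p(A,B,k) ≤ i.

module Submission where

open import Defs
open import Data.Bool using (Bool; true; false; if_then_else_; not; _∧_; T)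
open import Data.Bool.Properties using (T-∧; T-≡; T-not-≡)
open import Data.Empty using (⊥-elim)
open import Data.Fin using (toℕ; fromℕ<) renaming (zero to fzero; suc to fsuc)
open import Data.Fin.Properties using (toℕ-injective; toℕ-fromℕ<; toℕ<n)
open import Data.Fin.Subset using (Subset; _⊆_)
open import Data.Fin.Subset.Properties using (drop-∷-⊆)
open import Data.List using (filterᵇ; foldr)
open import Data.List.Properties using (foldr-forcesᵇ; foldr-preservesᵇ)
open import Data.List.Membership.Propositional using (_∈_)
open import Data.List.Membership.Propositional.Properties
  using (∈-applyUpTo⁺; ∈-applyUpTo⁻; ∈-filter⁺; ∈-filter⁻)
open import Data.List.Relation.Unary.All as All using (All)
open import Data.Nat
  using (ℕ; zero; suc; _+_; _*_; _∸_; _⊔_; _⊓_; ∣_-_∣; _≤_; _<_; _<ᵇ_; z≤n; s≤s; s≤s⁻¹; z<s; s<s; s<s⁻¹)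
open import Data.Nat.Properties
open import Data.Product using (_×_; _,_; proj₁; proj₂)
open import Data.Product.Function.NonDependent.Propositional using (_×-⇔_)
open import Data.Sum using (_⊎_; inj₁; inj₂)
open import Data.Vec using ([]; _∷_; lookup; here)
open import Data.Vec.Properties using (lookup⇒[]=; []=⇒lookup)
open import Function using (_∘_)
open import Function.Bundles using (_⇔_; mk⇔; Equivalence)
open import Function.Construct.Composition using (_⇔-∘_)
open import Function.Construct.Identity using (⇔-id)
open import Function.Construct.Symmetry using (⇔-sym)
open import Relation.Binary.PropositionalEquality
  using (_≡_; _≢_; refl; sym; trans; cong; cong₂; subst; subst₂)
open import Relation.Nullary using (¬_; contradiction)
open import Relation.Nullary.Decidable using (T?)

open Equivalence using (to; from)

Near : ℕ → ℕ → Set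
Near x y = ∣ x - y ∣ ≤ 1

near-refl : ∀ {x y} → x ≡ y → Near x y
near-refl {x} refl = subst (_≤ 1) (sym (∣n-n∣≡0 x)) z≤n

-- Column of the king of square t + 1 (so t counts squares from 0), left column iff the flag is set.
col : Bool → ℕ → ℕ
col b zero    = if b then 1 else 2
col b (suc t) = suc (suc (col b t))

col-spec : ∀ b t → col b t ≡ (if b then 2 * suc t ∸ 1 else 2 * suc t)
col-spec true  zero    = refl
col-spec false zero    = refl
col-spec true  (suc t) = trans (cong (suc ∘ suc) (col-spec true t)) (cong (_∸ 1) (sym (*-suc 2 (suc t))))
col-spec false (suc t) = trans (cong (suc ∘ suc) (col-spec false t)) (sym (*-suc 2 (suc t)))

data ColumnsTouch : Bool → ℕ → Bool → ℕ → Set where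
  same-square : ∀ {b b' t} → ColumnsTouch b t b' t
  right-left  : ∀ {t} → ColumnsTouch false t true (suc t)
  left-right  : ∀ {t} → ColumnsTouch true (suc t) false t

flip-touch : ∀ {b b' t t'} → ColumnsTouch b' t' b t → ColumnsTouch b t b' t'
flip-touch same-square = same-square
flip-touch right-left  = left-right
flip-touch left-right  = right-left

suc-touch : ∀ {b b' t t'} → ColumnsTouch b t b' t' → ColumnsTouch b (suc t) b' (suc t')
suc-touch same-square = same-square
suc-touch right-left  = right-left
suc-touch left-right  = left-right

near-first⇒columns-touch : ∀ b b' t' → Near (col b zero) (col b' (suc t')) → ColumnsTouch b zero b' (suc t')
near-first⇒columns-touch false true  zero     _        = right-left
near-first⇒columns-touch true  true  zero     (s≤s ())
near-first⇒columns-touch true  false zero     (s≤s ())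
near-first⇒columns-touch false false zero     (s≤s ())
near-first⇒columns-touch true  _     (suc t') (s≤s ())
near-first⇒columns-touch false _     (suc t') (s≤s ())

near⇒columns-touch : ∀ b b' t t' → Near (col b t) (col b' t') → ColumnsTouch b t b' t'
near⇒columns-touch b b' zero    zero     _ = same-square
near⇒columns-touch b b' zero    (suc t') h = near-first⇒columns-touch b b' t' h
near⇒columns-touch b b' (suc t) zero     h =
  flip-touch (near-first⇒columns-touch b' b t (subst (_≤ 1) (∣-∣-comm (col b (suc t)) (col b' zero)) h))
near⇒columns-touch b b' (suc t) (suc t') h = suc-touch (near⇒columns-touch b b' t t' h)

columns-touch⇒near : ∀ {b b' t t'} → ColumnsTouch b t b' t' → Near (col b t) (col b' t')
columns-touch⇒near {b} {b'} {t} same-square = same b b' t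
  where
  same : ∀ b b' t → Near (col b t) (col b' t)
  same true  true  zero    = z≤n
  same true  false zero    = s≤s z≤n
  same false true  zero    = s≤s z≤n
  same false false zero    = z≤n
  same b     b'    (suc t) = same b b' t
columns-touch⇒near {t = t} right-left = adjacent t
  where
  adjacent : ∀ t → Near (col false t) (col true (suc t))
  adjacent zero    = s≤s z≤n
  adjacent (suc t) = adjacent t
columns-touch⇒near {t' = t'} left-right =
  subst (_≤ 1) (∣-∣-comm (col false t') (col true (suc t'))) (columns-touch⇒near (right-left {t'}))

T-<ᵇ⇔ : ∀ {m n} → T (m <ᵇ n) ⇔ m < n
T-<ᵇ⇔ {m} {n} = mk⇔ (<ᵇ⇒< m n) <⇒<ᵇ

<ᵇ≡true⇔ : ∀ {m n} → (m <ᵇ n) ≡ true ⇔ m < n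
<ᵇ≡true⇔ = T-<ᵇ⇔ ⇔-∘ ⇔-sym T-≡

<ᵇ≡false⇔ : ∀ {m n} → (m <ᵇ n) ≡ false ⇔ n ≤ m
<ᵇ≡false⇔ {m} {n} = mk⇔ (λ e → ≮⇒≥ (subst T e ∘ <⇒<ᵇ)) ≥⇒<ᵇ≡false
  where
  ≥⇒<ᵇ≡false : n ≤ m → (m <ᵇ n) ≡ false
  ≥⇒<ᵇ≡false n≤m with m <ᵇ n in e
  ... | false = refl
  ... | true  = contradiction (<ᵇ⇒< m n (from T-≡ e)) (≤⇒≯ n≤m)

column : ℕ → ℕ → ℕ
column k t = col (suc t <ᵇ k) t

data SquaresTouch (k k' : ℕ) : ℕ → ℕ → Set where
  same-square : ∀ {t} → SquaresTouch k k' t t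
  right-left  : ∀ {t} → k ≤ suc t → suc (suc t) < k' → SquaresTouch k k' t (suc t)
  left-right  : ∀ {t} → suc (suc t) < k → k' ≤ suc t → SquaresTouch k k' (suc t) t

near-columns⇔squares-touch : ∀ {k k' t t'} → Near (column k t) (column k' t') ⇔ SquaresTouch k k' t t'
near-columns⇔squares-touch {k} {k'} {t} {t'} =
  mk⇔ (columns⇒squares-touch ∘ near⇒columns-touch _ _ t t') (columns-touch⇒near ∘ squares⇒columns-touch)
  where
  columns⇒squares-touch : ∀ {t t'} → ColumnsTouch (suc t <ᵇ k) t (suc t' <ᵇ k') t' → SquaresTouch k k' t t'
  columns⇒squares-touch {t} {t'} c with suc t <ᵇ k in e | suc t' <ᵇ k' in e' | c
  ... | _ | _ | same-square = same-square
  ... | _ | _ | right-left  = right-left (to <ᵇ≡false⇔ e) (to <ᵇ≡true⇔ e')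
  ... | _ | _ | left-right  = left-right (to <ᵇ≡true⇔ e) (to <ᵇ≡false⇔ e')
  squares⇒columns-touch : ∀ {t t'} → SquaresTouch k k' t t' → ColumnsTouch (suc t <ᵇ k) t (suc t' <ᵇ k') t'
  squares⇒columns-touch same-square = same-square
  squares⇒columns-touch (right-left k≤ <k')
    rewrite from <ᵇ≡false⇔ k≤ | from <ᵇ≡true⇔ <k' = right-left
  squares⇒columns-touch (left-right <k k'≤)
    rewrite from <ᵇ≡true⇔ <k | from <ᵇ≡false⇔ k'≤ = left-right

near-columns⇒same-square : ∀ {k t t'} → Near (column k t) (column k t') → t ≡ t'
near-columns⇒same-square {k} {t} {t'} h with to (near-columns⇔squares-touch {k} {k} {t} {t'}) h
... | same-square     = refl
... | right-left k≤ <k = contradiction (≤-trans k≤ (n≤1+n _)) (<⇒≱ <k)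
... | left-right <k k≤ = contradiction (≤-trans k≤ (n≤1+n _)) (<⇒≱ <k)

∈ℕᵇ-lookup : ∀ {n} (A : Subset n) j → suc (toℕ j) ∈ℕᵇ A ≡ lookup A j
∈ℕᵇ-lookup (_ ∷ _) fzero    = refl
∈ℕᵇ-lookup (_ ∷ A) (fsuc j) = ∈ℕᵇ-lookup A j

0∉ℕᵇ : ∀ {n} (A : Subset n) → (0 ∈ℕᵇ A) ≢ true
0∉ℕᵇ []      ()
0∉ℕᵇ (_ ∷ _) ()

∈ℕᵇ⇒< : ∀ {n} (A : Subset n) t → (suc t ∈ℕᵇ A) ≡ true → t < n
∈ℕᵇ⇒< (_ ∷ _) zero    _ = z<s
∈ℕᵇ⇒< (_ ∷ A) (suc t) e = s<s (∈ℕᵇ⇒< A t e)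

_⊆ℕᵇ_ : ∀ {n} → Subset n → Subset n → Set
B ⊆ℕᵇ A = ∀ j → (j ∈ℕᵇ B) ≡ true → (j ∈ℕᵇ A) ≡ true

⊆⇔⊆ℕᵇ : ∀ {n} {A B : Subset n} → B ⊆ A ⇔ B ⊆ℕᵇ A
⊆⇔⊆ℕᵇ {A = A} {B} = mk⇔ ⊆⇒ ⊆⇐
  where
  ⊆⇒ : ∀ {n} {A B : Subset n} → B ⊆ A → B ⊆ℕᵇ A
  ⊆⇒ {B = B}     _   zero          e    = contradiction e (0∉ℕᵇ B)
  ⊆⇒ {A = _ ∷ _} {_ ∷ _} sub (suc zero) refl with sub here
  ... | here = refl
  ⊆⇒ {A = _ ∷ _} {_ ∷ _} sub (suc (suc j)) e = ⊆⇒ (drop-∷-⊆ sub) (suc j) e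
  ⊆⇐ : B ⊆ℕᵇ A → B ⊆ A
  ⊆⇐ h {x} x∈B =
    lookup⇒[]= x A (trans (sym (∈ℕᵇ-lookup A x)) (h _ (trans (∈ℕᵇ-lookup B x) ([]=⇒lookup x∈B))))

king : ∀ {n} → ℕ → Subset n → ℕ → ℕ → Cell
king off A k t = off + (if suc t ∈ℕᵇ A then 1 else 2) , column k t

R≡king : ∀ {n} off (A : Subset n) k j → R off A k j ≡ king off A k (toℕ j)
R≡king off A k j =
  cong₂ _,_ (cong (λ a → off + (if a then 1 else 2)) (sym (∈ℕᵇ-lookup A j)))
            (sym (col-spec (suc (toℕ j) <ᵇ k) (toℕ j)))

R-nonattacking : ∀ {n} off (A : Subset n) k → NonattackingPlacement (R off A k)
R-nonattacking off A k =
  (λ j j' → column-injective ∘ near-refl ∘ cong proj₂) ,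
  (λ { j j' (j≢j' , _ , near) → j≢j' (cong (R off A k) (column-injective near)) })
  where
  column-injective : ∀ {j j'} → Near (proj₂ (R off A k j)) (proj₂ (R off A k j')) → j ≡ j'
  column-injective {j} {j'} =
    toℕ-injective ∘ near-columns⇒same-square {k}
      ∘ subst₂ Near (cong proj₂ (R≡king off A k j)) (cong proj₂ (R≡king off A k j'))

attack-sym : ∀ c c' → Attack c c' → Attack c' c
attack-sym (r , c) (r' , c') (c≢c' , rows , columns) =
  c≢c' ∘ sym , subst (_≤ 1) (∣-∣-comm r r') rows , subst (_≤ 1) (∣-∣-comm c c') columns

⊎-nonattacking : ∀ {I J : Set} (f : I ⊎ J → Cell) →
  NonattackingPlacement (f ∘ inj₁) → NonattackingPlacement (f ∘ inj₂) →
  (∀ x y → f (inj₁ x) ≢ f (inj₂ y)) → (∀ x y → ¬ Attack (f (inj₁ x)) (f (inj₂ y))) →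
  NonattackingPlacement f
⊎-nonattacking f (inj-I , na-I) (inj-J , na-J) disjoint na-IJ = injective , nonattacking
  where
  injective : ∀ u v → f u ≡ f v → u ≡ v
  injective (inj₁ x) (inj₁ y) e = cong inj₁ (inj-I x y e)
  injective (inj₂ x) (inj₂ y) e = cong inj₂ (inj-J x y e)
  injective (inj₁ x) (inj₂ y) e = contradiction e (disjoint x y)
  injective (inj₂ x) (inj₁ y) e = contradiction (sym e) (disjoint y x)
  nonattacking : ∀ u v → ¬ Attack (f u) (f v)
  nonattacking (inj₁ x) (inj₁ y) = na-I x y
  nonattacking (inj₂ x) (inj₂ y) = na-J x y
  nonattacking (inj₁ x) (inj₂ y) = na-IJ x y
  nonattacking (inj₂ x) (inj₁ y) = na-IJ y x ∘ attack-sym (f (inj₂ x)) (f (inj₁ y))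

upper-lower-rows-differ : ∀ a b → (if a then 1 else 2) ≢ 2 + (if b then 1 else 2)
upper-lower-rows-differ true  _     ()
upper-lower-rows-differ false true  ()
upper-lower-rows-differ false false ()

upper-lower-rows-near : ∀ a b → Near (if a then 1 else 2) (2 + (if b then 1 else 2)) → a ≡ false × b ≡ true
upper-lower-rows-near false true  _        = refl , refl
upper-lower-rows-near true  true  (s≤s ())
upper-lower-rows-near true  false (s≤s ())
upper-lower-rows-near false false (s≤s ())

upper-lower-attack⇔ : ∀ {n} (A B : Subset n) k i t t' →
  Attack (king 0 A k t) (king 2 B i t') ⇔
  ((suc t ∈ℕᵇ A) ≡ false × (suc t' ∈ℕᵇ B) ≡ true × SquaresTouch k i t t')
upper-lower-attack⇔ A B k i t t' = mk⇔ attack⇒ attack⇐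
  where
  attack⇒ : Attack (king 0 A k t) (king 2 B i t') →
    (suc t ∈ℕᵇ A) ≡ false × (suc t' ∈ℕᵇ B) ≡ true × SquaresTouch k i t t'
  attack⇒ (_ , rows , columns) =
    let a∉ , b∈ = upper-lower-rows-near _ _ rows in a∉ , b∈ , to near-columns⇔squares-touch columns
  attack⇐ : (suc t ∈ℕᵇ A) ≡ false × (suc t' ∈ℕᵇ B) ≡ true × SquaresTouch k i t t' →
    Attack (king 0 A k t) (king 2 B i t')
  attack⇐ (a∉ , b∈ , touch) rewrite a∉ | b∈ =
    (λ ()) , s≤s z≤n , from near-columns⇔squares-touch touch

foldr-⊔-≤⇔ : ∀ {b m} xs → b ≤ m → (foldr _⊔_ b xs ≤ m ⇔ All (_≤ m) xs)
foldr-⊔-≤⇔ xs b≤m =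
  mk⇔ (foldr-forcesᵇ (λ x y h → m⊔n≤o⇒m≤o x y h , m⊔n≤o⇒n≤o x y h) _ xs) (foldr-preservesᵇ ⊔-lub b≤m)

≤-foldr-⊓⇔ : ∀ {b m} xs → m ≤ b → (m ≤ foldr _⊓_ b xs ⇔ All (m ≤_) xs)
≤-foldr-⊓⇔ xs m≤b =
  mk⇔ (foldr-forcesᵇ (λ x y h → m≤n⊓o⇒m≤n x y h , m≤n⊓o⇒m≤o x y h) _ xs) (foldr-preservesᵇ ⊓-glb m≤b)

All-filterᵇ-range1⇔ : ∀ {Q : ℕ → Set} (P : ℕ → Bool) n →
  All Q (filterᵇ P (range1 n)) ⇔ (∀ t → t < suc n → T (P (suc t)) → Q (suc t))
All-filterᵇ-range1⇔ {Q} P n = mk⇔ all⇒ (λ h → All.tabulate (all⇐ h))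
  where
  all⇒ : All Q (filterᵇ P (range1 n)) → ∀ t → t < suc n → T (P (suc t)) → Q (suc t)
  all⇒ all t t< Pt = All.lookup all (∈-filter⁺ (T? ∘ P) (∈-applyUpTo⁺ suc t<) Pt)
  all⇐ : (∀ t → t < suc n → T (P (suc t)) → Q (suc t)) → ∀ {x} → x ∈ filterᵇ P (range1 n) → Q x
  all⇐ h x∈ with ∈-filter⁻ (T? ∘ P) x∈
  ... | x∈range , Px with ∈-applyUpTo⁻ suc x∈range
  ...   | t , t< , refl = h t t< Px

pCandidate : ∀ {n} → Subset n → Subset n → ℕ → ℕ → Bool
pCandidate A B k j = (j <ᵇ k) ∧ not (j ∈ℕᵇ A) ∧ ((j ∸ 1) ∈ℕᵇ B)

qCandidate : ∀ {n} → Subset n → Subset n → ℕ → ℕ → Bool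
qCandidate A B k j = (k <ᵇ j) ∧ (j ∈ℕᵇ B) ∧ not ((j ∸ 1) ∈ℕᵇ A)

pCandidate⇔ : ∀ {n} (A B : Subset n) k j →
  T (pCandidate A B k j) ⇔ (j < k × (j ∈ℕᵇ A) ≡ false × ((j ∸ 1) ∈ℕᵇ B) ≡ true)
pCandidate⇔ _ _ _ _ = (T-<ᵇ⇔ ×-⇔ T-not-≡ ×-⇔ T-≡) ⇔-∘ ((⇔-id _ ×-⇔ T-∧) ⇔-∘ T-∧)

qCandidate⇔ : ∀ {n} (A B : Subset n) k j →
  T (qCandidate A B k j) ⇔ (k < j × (j ∈ℕᵇ B) ≡ true × ((j ∸ 1) ∈ℕᵇ A) ≡ false)
qCandidate⇔ _ _ _ _ = (T-<ᵇ⇔ ×-⇔ T-≡ ×-⇔ T-not-≡) ⇔-∘ ((⇔-id _ ×-⇔ T-∧) ⇔-∘ T-∧)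

PBound : ∀ {n} → Subset n → Subset n → ℕ → ℕ → Set
PBound {n} A B k i = ∀ t → t < suc n → T (pCandidate A B k (suc t)) → suc t ≤ i

QBound : ∀ {n} → Subset n → Subset n → ℕ → ℕ → Set
QBound {n} A B k i = ∀ t → t < suc n → T (qCandidate A B k (suc t)) → i ≤ suc t

p≤⇔ : ∀ {n} (A B : Subset n) k {i} → 1 ≤ i → p A B k ≤ i ⇔ PBound A B k i
p≤⇔ {n} A B k 1≤i = All-filterᵇ-range1⇔ (pCandidate A B k) n ⇔-∘ foldr-⊔-≤⇔ _ 1≤i

≤q⇔ : ∀ {n} (A B : Subset n) k {i} → i ≤ suc n → i ≤ q A B k ⇔ QBound A B k i
≤q⇔ {n} A B k i≤ = All-filterᵇ-range1⇔ (qCandidate A B k) n ⇔-∘ ≤-foldr-⊓⇔ _ i≤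

module _ {n} (A : Subset n) (k : ℕ) (B : Subset n) (i : ℕ) where

  NoCrossAttack : Set
  NoCrossAttack = ∀ t t' → t < n → t' < n → ¬ Attack (king 0 A k t) (king 2 B i t')

  stacked-nonattacking⇔ : NonattackingPlacement (stacked A k B i) ⇔ NoCrossAttack
  stacked-nonattacking⇔ =
    mk⇔ no-cross (⊎-nonattacking _ (R-nonattacking 0 A k) (R-nonattacking 2 B i) disjoint ∘ cross)
    where
    king-at : ∀ off (C : Subset n) kk {t} (t<n : t < n) → R off C kk (fromℕ< t<n) ≡ king off C kk t
    king-at off C kk t<n = trans (R≡king off C kk (fromℕ< t<n)) (cong (king off C kk) (toℕ-fromℕ< t<n))
    no-cross : NonattackingPlacement (stacked A k B i) → NoCrossAttack
    no-cross (_ , na) t t' t<n t'<n =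
      subst₂ (λ c c' → ¬ Attack c c') (king-at 0 A k t<n) (king-at 2 B i t'<n)
        (na (inj₁ (fromℕ< t<n)) (inj₂ (fromℕ< t'<n)))
    cross : NoCrossAttack → ∀ j j' → ¬ Attack (R 0 A k j) (R 2 B i j')
    cross nc j j' = subst₂ (λ c c' → ¬ Attack c c') (sym (R≡king 0 A k j)) (sym (R≡king 2 B i j'))
      (nc (toℕ j) (toℕ j') (toℕ<n j) (toℕ<n j'))
    disjoint : ∀ j j' → R 0 A k j ≢ R 2 B i j'
    disjoint j j' = upper-lower-rows-differ (lookup A j) (lookup B j') ∘ cong proj₁

  no-cross-attack : B ⊆ℕᵇ A → PBound A B k i → QBound A B k i → NoCrossAttack
  no-cross-attack B⊆A pb qb t t' t<n t'<n attack with to (upper-lower-attack⇔ A B k i t t') attack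
  ... | a∉ , b∈ , same-square       = contradiction (trans (sym (B⊆A _ b∈)) a∉) λ ()
  ... | a∉ , b∈ , right-left k≤ <i  =
    contradiction (qb t' (m<n⇒m<1+n t'<n) (from (qCandidate⇔ A B k (suc t')) (s≤s k≤ , b∈ , a∉)))
                  (<⇒≱ <i)
  ... | a∉ , b∈ , left-right <k i≤  =
    contradiction (pb t (m<n⇒m<1+n t<n) (from (pCandidate⇔ A B k (suc t)) (<k , a∉ , b∈)))
                  (<⇒≱ (s≤s i≤))

  subset-bound : NoCrossAttack → B ⊆ℕᵇ A
  subset-bound nc zero    b∈ = contradiction b∈ (0∉ℕᵇ B)
  subset-bound nc (suc t) b∈ with suc t ∈ℕᵇ A in a
  ... | true  = refl
  ... | false = ⊥-elim (nc t t t<n t<n (from (upper-lower-attack⇔ A B k i t t) (a , b∈ , same-square)))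
    where t<n = ∈ℕᵇ⇒< B t b∈

  p-bound : k ≤ suc n → NoCrossAttack → PBound A B k i
  p-bound k≤ nc zero _ candidate =
    contradiction (proj₂ (proj₂ (to (pCandidate⇔ A B k 1) candidate))) (0∉ℕᵇ B)
  p-bound k≤ nc (suc t) _ candidate
    with to (pCandidate⇔ A B k (suc (suc t))) candidate | ≤-<-connex (suc (suc t)) i
  ... | _            | inj₁ ≤i = ≤i
  ... | <k , a∉ , b∈ | inj₂ i< =
    ⊥-elim (nc (suc t) t (s<s⁻¹ (<-≤-trans <k k≤)) (∈ℕᵇ⇒< B t b∈)
      (from (upper-lower-attack⇔ A B k i (suc t) t) (a∉ , b∈ , left-right <k (s≤s⁻¹ i<))))

  q-bound : 1 ≤ k → NoCrossAttack → QBound A B k i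
  q-bound 1≤k nc zero _ candidate = contradiction 1≤k (<⇒≱ (proj₁ (to (qCandidate⇔ A B k 1) candidate)))
  q-bound 1≤k nc (suc t) _ candidate
    with to (qCandidate⇔ A B k (suc (suc t))) candidate | ≤-<-connex i (suc (suc t))
  ... | _            | inj₁ i≤ = i≤
  ... | k< , b∈ , a∉ | inj₂ <i =
    ⊥-elim (nc t (suc t) (<-trans (n<1+n t) t+1<n) t+1<n
      (from (upper-lower-attack⇔ A B k i t (suc t)) (a∉ , b∈ , right-left (s≤s⁻¹ k<) <i)))
    where t+1<n = ∈ℕᵇ⇒< B (suc t) b∈

  no-cross-attack⇔ : 1 ≤ k → k ≤ suc n →
    NoCrossAttack ⇔ (B ⊆ℕᵇ A × PBound A B k i × QBound A B k i)
  no-cross-attack⇔ 1≤k k≤ =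
    mk⇔ (λ nc → subset-bound nc , p-bound k≤ nc , q-bound 1≤k nc)
        (λ (B⊆A , pb , qb) → no-cross-attack B⊆A pb qb)

proposition1 : (n : ℕ) → 1 ≤ n → (A : Subset n) (k : ℕ) → 1 ≤ k → k ≤ suc n →
    (B : Subset n) (i : ℕ) → 1 ≤ i → i ≤ suc n →
    NonattackingPlacement (stacked A k B i) ⇔ (B ⊆ A × p A B k ≤ i × i ≤ q A B k)
proposition1 n _ A k 1≤k k≤ B i 1≤i i≤ =
  (⇔-sym ⊆⇔⊆ℕᵇ ×-⇔ ⇔-sym (p≤⇔ A B k 1≤i) ×-⇔ ⇔-sym (≤q⇔ A B k i≤))
    ⇔-∘ (no-cross-attack⇔ A k B i 1≤k k≤ ⇔-∘ stacked-nonattacking⇔ A k B i)
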